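{- Let $(X,\tau,\beta,\nu)$ be a computable $T_0$ space. The complement of an effectively nowhere dense subset of $X$ contains a dense c.e. open set.
   Context: $\Sigma^*$ is the set of finite binary strings. A computable $T_0$ space is a tuple $(X,\tau,\beta,\nu)$ where $(X,\tau)$ is a second countable $T_0$ space, $\beta$ is a countable basis of non-empty open sets, and $\nu:\Sigma^*\dashrightarrow\beta$ is a partial computable surjection such that there is a c.e. set $B\subseteq(\Sigma^*)^3$ with $\nu(u)\cap\nu(v)=\bigcup\{\nu(w):(u,v,w)\in B\}$ for all $u,v\in\mathrm{dom}(\nu)$. A set is c.e. open if it is the union of a computably enumerable family of basic open sets. A set $A\subseteq X$ is effectively nowhere dense if there exists a computable $f:\Sigma^*\to\Sigma^*$ such that $\nu(f(w))\subseteq(\nu(w)\setminus A)^{o}$ for all $w\in\mathrm{dom}(\nu)$. -}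

module Defs where

open import Level using (0ℓ)
open import Data.Bool using (Bool; true; false)
open import Data.List using (List; []; _∷_)
open import Data.Maybe using (Maybe; just; nothing)
open import Data.Nat using (ℕ; zero; suc; _+_; _*_; _<_)
open import Data.Fin using (Fin)
open import Data.Vec using (Vec; []; _∷_; lookup)
open import Data.Product using (Σ; ∃; _×_; _,_)
open import Data.Unit using (⊤)
open import Data.Empty using (⊥)
open import Relation.Nullary using (¬_)
open import Relation.Binary.PropositionalEquality using (_≡_)

Σ* : Set
Σ* = List Bool

enc : Σ* → ℕ
enc []          = 0
enc (false ∷ s) = 1 + 2 * enc s
enc (true  ∷ s) = 2 + 2 * enc s

data PR : ℕ → Set where
  Z    : ∀ {n} → PR n
  S    : PR 1
  proj : ∀ {n} → Fin n → PR n
  comp : ∀ {m n} → PR m → Vec (PR n) m → PR n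
  prim : ∀ {n} → PR n → PR (suc (suc n)) → PR (suc n)
  mu   : ∀ {n} → PR (suc n) → PR n

data _[_]⇓_ : ∀ {n} → PR n → Vec ℕ n → ℕ → Set
data _[_]⇓*_ : ∀ {m n} → Vec (PR n) m → Vec ℕ n → Vec ℕ m → Set

data _[_]⇓_ where
  Z-ev    : ∀ {n} {xs : Vec ℕ n} → Z [ xs ]⇓ 0
  S-ev    : ∀ {x} → S [ x ∷ [] ]⇓ suc x
  proj-ev : ∀ {n} {i : Fin n} {xs} → proj i [ xs ]⇓ lookup xs i
  comp-ev : ∀ {m n} {f : PR m} {gs : Vec (PR n) m} {xs ys y} →
            gs [ xs ]⇓* ys → f [ ys ]⇓ y → comp f gs [ xs ]⇓ y
  prim-z  : ∀ {n} {f : PR n} {g} {xs y} →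
            f [ xs ]⇓ y → prim f g [ 0 ∷ xs ]⇓ y
  prim-s  : ∀ {n} {f : PR n} {g} {xs k r y} →
            prim f g [ k ∷ xs ]⇓ r → g [ k ∷ r ∷ xs ]⇓ y →
            prim f g [ suc k ∷ xs ]⇓ y
  mu-ev   : ∀ {n} {f : PR (suc n)} {xs k} →
            f [ k ∷ xs ]⇓ 0 →
            (∀ j → j < k → ∃ λ m → f [ j ∷ xs ]⇓ suc m) →
            mu f [ xs ]⇓ k

data _[_]⇓*_ where
  []-ev : ∀ {n} {xs : Vec ℕ n} → [] [ xs ]⇓* []
  ∷-ev  : ∀ {m n} {g : PR n} {gs : Vec (PR n) m} {xs y ys} →
          g [ xs ]⇓ y → gs [ xs ]⇓* ys → (g ∷ gs) [ xs ]⇓* (y ∷ ys)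

CE : (Σ* → Set) → Set
CE P = Σ (PR 1) λ c → ∀ u → (P u → ∃ λ y → c [ enc u ∷ [] ]⇓ y)
                           × ((∃ λ y → c [ enc u ∷ [] ]⇓ y) → P u)

CE₃ : (Σ* → Σ* → Σ* → Set) → Set
CE₃ P = Σ (PR 3) λ c → ∀ u v w →
          (P u v w → ∃ λ y → c [ enc u ∷ enc v ∷ enc w ∷ [] ]⇓ y)
        × ((∃ λ y → c [ enc u ∷ enc v ∷ enc w ∷ [] ]⇓ y) → P u v w)

Computable : (Σ* → Σ*) → Set
Computable f = Σ (PR 1) λ c → ∀ u → c [ enc u ∷ [] ]⇓ enc (f u)

Subset : Set → Set₁
Subset X = X → Set

Defined : {A : Set₁} → Maybe A → Set
Defined (just _) = ⊤
Defined nothing  = ⊥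

record ComputableT0Space (X : Set) : Set₁ where
  field
    IsOpen     : Subset X → Set
    open-univ  : IsOpen (λ _ → ⊤)
    open-union : ∀ {I : Set} (F : I → Subset X) →
                 (∀ i → IsOpen (F i)) → IsOpen (λ x → Σ I λ i → F i x)
    open-inter : ∀ (U V : Subset X) → IsOpen U → IsOpen V →
                 IsOpen (λ x → U x × V x)
    open-ext   : ∀ (U V : Subset X) → (∀ x → U x → V x) →
                 (∀ x → V x → U x) → IsOpen U → IsOpen V
    T0         : ∀ x y → (∀ U → IsOpen U → (U x → U y) × (U y → U x)) → x ≡ y
    -- the numbering ν : Σ* ⇀ β of the (countable) basis β = image of ν
    ν          : Σ* → Maybe (Subset X)
    dom-ce     : CE (λ u → Defined (ν u))
    basic-open : ∀ u B → ν u ≡ just B → IsOpen B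
    basic-ne   : ∀ u B → ν u ≡ just B → ∃ λ x → B x
    basis      : ∀ U → IsOpen U → ∀ x → U x →
                 Σ Σ* λ u → Σ (Subset X) λ B → ν u ≡ just B × B x × (∀ y → B y → U y)
    Bset       : Σ* → Σ* → Σ* → Set
    Bset-ce    : CE₃ Bset
    inter      : ∀ u v Bu Bv → ν u ≡ just Bu → ν v ≡ just Bv → ∀ x →
                 ((Bu x × Bv x) →
                    Σ Σ* λ w → Σ (Subset X) λ Bw → Bset u v w × ν w ≡ just Bw × Bw x)
               × ((Σ Σ* λ w → Σ (Subset X) λ Bw → Bset u v w × ν w ≡ just Bw × Bw x) →
                    Bu x × Bv x)

module _ {X : Set} (𝕏 : ComputableT0Space X) where
  open ComputableT0Space 𝕏

  Interior : Subset X → X → Set₁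
  Interior A x = Σ (Subset X) λ U → IsOpen U × U x × (∀ y → U y → A y)

  CEOpen : Subset X → Set₁
  CEOpen D = Σ (Σ* → Set) λ E → CE E
             × (∀ w → E w → Σ (Subset X) λ B → ν w ≡ just B)
             × (∀ x → (D x → Σ Σ* λ w → Σ (Subset X) λ B → E w × ν w ≡ just B × B x)
                    × ((Σ Σ* λ w → Σ (Subset X) λ B → E w × ν w ≡ just B × B x) → D x))

  Dense : Subset X → Set₁
  Dense D = ∀ U → IsOpen U → (∃ λ x → U x) → ∃ λ x → U x × D x

  EffNowhereDense : Subset X → Set₁
  EffNowhereDense A = Σ (Σ* → Σ*) λ f → Computable f ×
    (∀ w Bw → ν w ≡ just Bw →
       Σ (Subset X) λ Bf → ν (f w) ≡ just Bf ×
         (∀ x → Bf x → Interior (λ y → Bw y × ¬ A y) x))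

-- Write f for the computable witness of effective nowhere density. For each index w of a
-- basic set, ν (f w) is a basic set inside the interior of ν w ∖ A. The union D of these sets
-- over w ∈ dom ν therefore avoids A and meets every basic set, so it is dense. D is c.e. open
-- because its index set, the image of the c.e. set dom ν under f, is c.e.: a μ-search over
-- clocks s looks for some w < s on which both the program for dom ν and the program for f
-- halt within s, and evaluation cut off at a clock is itself computed by a total program.

module Submission where

open import Defs
open import Data.Bool using (true; false)
open import Data.Empty using (⊥; ⊥-elim)
open import Data.Fin using (Fin; zero; suc)
open import Data.List using ([]; _∷_)
open import Data.Maybe using (Maybe; just; nothing)
open import Data.Nat
open import Data.Nat.Properties
open import Data.Product using (Σ; ∃; _×_; _,_; proj₁; proj₂)
open import Data.Sum using (_⊎_; inj₁; inj₂; [_,_]′)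
open import Data.Unit using (tt)
open import Data.Vec using (Vec; []; _∷_; head; tail; lookup; tabulate; map)
open import Data.Vec.Properties using (tabulate∘lookup; ∷-injective; map-∘; map-id)
open import Function using (_∘_)
open import Relation.Binary.Definitions using (tri<; tri≈; tri>)
open import Relation.Binary.PropositionalEquality
open import Relation.Nullary using (¬_)

private
  variable
    k m n : ℕ
    xs : Vec ℕ n

⇓-functional : ∀ {c : PR n} {y y′} → c [ xs ]⇓ y → c [ xs ]⇓ y′ → y ≡ y′
⇓*-functional : ∀ {cs : Vec (PR n) m} {ys ys′} → cs [ xs ]⇓* ys → cs [ xs ]⇓* ys′ → ys ≡ ys′

⇓-functional Z-ev Z-ev = refl
⇓-functional S-ev S-ev = refl
⇓-functional proj-ev proj-ev = refl
⇓-functional (comp-ev ds d) (comp-ev ds′ d′) with ⇓*-functional ds ds′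
... | refl = ⇓-functional d d′
⇓-functional (prim-z d) (prim-z d′) = ⇓-functional d d′
⇓-functional (prim-s d e) (prim-s d′ e′) with ⇓-functional d d′
... | refl = ⇓-functional e e′
⇓-functional (mu-ev {k = k} d below) (mu-ev {k = k′} d′ below′) with <-cmp k k′
... | tri≈ _ k≡k′ _ = k≡k′
... | tri< k<k′ _ _ = ⊥-elim (0≢1+n (⇓-functional d (proj₂ (below′ k k<k′))))
... | tri> _ _ k′<k = ⊥-elim (0≢1+n (⇓-functional d′ (proj₂ (below k′ k′<k))))

⇓*-functional []-ev []-ev = refl
⇓*-functional (∷-ev d ds) (∷-ev d′ ds′) = cong₂ _∷_ (⇓-functional d d′) (⇓*-functional ds ds′)

Rep : ∀ n → (Vec ℕ n → ℕ) → Set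
Rep n g = Σ (PR n) λ c → ∀ xs → c [ xs ]⇓ g xs

Reps : ∀ n m → (Vec ℕ n → Vec ℕ m) → Set
Reps n m F = Σ (Vec (PR n) m) λ cs → ∀ xs → cs [ xs ]⇓* F xs

rep-ext : ∀ {g h} → Rep n g → (∀ xs → g xs ≡ h xs) → Rep n h
rep-ext (c , c⇓) g≗h = c , λ xs → subst (c [ xs ]⇓_) (g≗h xs) (c⇓ xs)

[]ʳ : Reps n 0 (λ _ → [])
[]ʳ = [] , λ _ → []-ev

infixr 5 _∷ʳ_
_∷ʳ_ : ∀ {g F} → Rep n g → Reps n m F → Reps n (suc m) (λ xs → g xs ∷ F xs)
(c , c⇓) ∷ʳ (cs , cs⇓) = c ∷ cs , λ xs → ∷-ev (c⇓ xs) (cs⇓ xs)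

rep-comp : ∀ {g F} → Rep m g → Reps n m F → Rep n (g ∘ F)
rep-comp (c , c⇓) (cs , cs⇓) = comp c cs , λ xs → comp-ev (cs⇓ xs) (c⇓ _)

comp-each : ∀ {gs : Vec (PR m) k} {fs : Vec (PR n) m} {ys zs} →
            gs [ ys ]⇓* zs → fs [ xs ]⇓* ys → map (λ g → comp g fs) gs [ xs ]⇓* zs
comp-each []-ev _ = []-ev
comp-each (∷-ev d ds) es = ∷-ev (comp-ev es d) (comp-each ds es)

reps-comp : ∀ {G F} → Reps m k G → Reps n m F → Reps n k (G ∘ F)
reps-comp (gs , gs⇓) (fs , fs⇓) = map (λ g → comp g fs) gs , λ xs → comp-each (gs⇓ _) (fs⇓ xs)

rep-proj : (i : Fin n) → Rep n (λ xs → lookup xs i)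
rep-proj i = proj i , λ _ → proj-ev

rep-head : Rep (suc n) head
rep-head = rep-ext (rep-proj zero) λ { (_ ∷ _) → refl }

projs⇓ : (ρ : Fin m → Fin n) (xs : Vec ℕ n) → tabulate (proj ∘ ρ) [ xs ]⇓* tabulate (lookup xs ∘ ρ)
projs⇓ {zero} ρ xs = []-ev
projs⇓ {suc m} ρ xs = ∷-ev proj-ev (projs⇓ (ρ ∘ suc) xs)

reps-tail : Reps (suc n) n tail
reps-tail = tabulate (proj ∘ suc) , λ { (x ∷ xs) → subst (_ [ x ∷ xs ]⇓*_) (tabulate∘lookup xs) (projs⇓ suc (x ∷ xs)) }

rep-S : Rep 1 (suc ∘ head)
rep-S = S , λ { (x ∷ []) → S-ev }

rep-suc : ∀ {a} → Rep n a → Rep n (suc ∘ a)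
rep-suc ra = rep-comp rep-S (ra ∷ʳ []ʳ)

rep-const : ∀ k → Rep n (λ _ → k)
rep-const zero = Z , λ _ → Z-ev
rep-const (suc k) = rep-suc (rep-const k)

reps-map : ∀ {h F} → Rep 1 (h ∘ head) → Reps n m F → Reps n m (map h ∘ F)
reps-map {n = n} {h = h} (c , c⇓) (cs , cs⇓) = map (λ d → comp c (d ∷ [])) cs , λ xs → each (cs⇓ xs)
  where
  each : ∀ {k} {ds : Vec (PR n) k} {xs ys} → ds [ xs ]⇓* ys → map (λ d → comp c (d ∷ [])) ds [ xs ]⇓* map h ys
  each []-ev = []-ev
  each (∷-ev d ds) = ∷-ev (comp-ev (∷-ev d []-ev) (c⇓ _)) (each ds)

primrec : ℕ → (ℕ → ℕ → ℕ) → ℕ → ℕ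
primrec b h zero    = b
primrec b h (suc k) = h k (primrec b h k)

rep-primrec : ∀ {B H} → Rep n B → Rep (suc (suc n)) H →
              Rep (suc n) (λ v → primrec (B (tail v)) (λ k r → H (k ∷ r ∷ tail v)) (head v))
rep-primrec {B = B} {H} (cb , cb⇓) (ch , ch⇓) = prim cb ch , λ { (k ∷ xs) → unfold k xs }
  where
  unfold : ∀ k xs → prim cb ch [ k ∷ xs ]⇓ primrec (B xs) (λ k r → H (k ∷ r ∷ xs)) k
  unfold zero    xs = prim-z (cb⇓ xs)
  unfold (suc k) xs = prim-s (unfold k xs) (ch⇓ _)

ifz : ℕ → ℕ → ℕ → ℕ
ifz zero    b c = b
ifz (suc _) b c = c

rep-ifz : ∀ {a b c} → Rep n a → Rep n b → Rep n c → Rep n (λ xs → ifz (a xs) (b xs) (c xs))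
rep-ifz ra rb rc = rep-comp ifz₃ (ra ∷ʳ rb ∷ʳ rc ∷ʳ []ʳ)
  where
  ifz₃ : Rep 3 (λ v → ifz (head v) (lookup v (suc zero)) (lookup v (suc (suc zero))))
  ifz₃ = rep-ext (rep-primrec (rep-proj zero) (rep-proj (suc (suc (suc zero)))))
           λ { (zero ∷ b ∷ c ∷ []) → refl ; (suc a ∷ b ∷ c ∷ []) → refl }

rep-pred : ∀ {a} → Rep n a → Rep n (pred ∘ a)
rep-pred ra = rep-comp pred₁ (ra ∷ʳ []ʳ)
  where
  pred₁ : Rep 1 (pred ∘ head)
  pred₁ = rep-ext (rep-primrec (rep-const 0) (rep-proj zero)) λ { (zero ∷ []) → refl ; (suc a ∷ []) → refl }

primrec-pred≡∸ : ∀ a b → primrec a (λ _ → pred) b ≡ a ∸ b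
primrec-pred≡∸ a       zero    = refl
primrec-pred≡∸ a       (suc b) = trans (cong pred (primrec-pred≡∸ a b)) (pred[m∸n]≡m∸[1+n] a b)

rep-∸ : ∀ {a b} → Rep n a → Rep n b → Rep n (λ xs → a xs ∸ b xs)
rep-∸ ra rb = rep-comp monus₂ (rb ∷ʳ ra ∷ʳ []ʳ)
  where
  monus₂ : Rep 2 (λ v → lookup v (suc zero) ∸ head v)
  monus₂ = rep-ext (rep-primrec (rep-proj zero) (rep-pred (rep-proj (suc zero)))) λ { (b ∷ a ∷ []) → primrec-pred≡∸ a b }

guard : ℕ → Vec ℕ m → ℕ
guard y []       = y
guard y (r ∷ rs) = ifz r 0 (guard y rs)

-- States of a μ-search cut off at a clock: 0 while searching, 1 after a probe without
-- an answer, 2 + k once the least zero k has been found.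
searchStep : ℕ → ℕ → ℕ
searchStep v i = ifz v 1 (ifz (pred v) (2 + i) 0)

search : (ℕ → ℕ) → ℕ → ℕ
search h = primrec 0 (λ i st → ifz st (searchStep (h i) i) st)

-- Every μ-search is cut off at the clock s; suc y encodes the value y and 0 the absence of an answer.
run : PR n → ℕ → Vec ℕ n → ℕ
runs : Vec (PR n) m → ℕ → Vec ℕ n → Vec ℕ m

run Z           s xs       = 1
run S           s (x ∷ []) = suc (suc x)
run (proj i)    s xs       = suc (lookup xs i)
run (comp f gs) s xs       = guard (run f s (map pred (runs gs s xs))) (runs gs s xs)
run (prim f g)  s (k ∷ xs) = primrec (run f s xs) (λ k r → ifz r 0 (run g s (k ∷ pred r ∷ xs))) k
run (mu f)      s xs       = pred (search (λ j → run f s (j ∷ xs)) s)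

runs []       s xs = []
runs (g ∷ gs) s xs = run g s xs ∷ runs gs s xs

rep-guard : ∀ m → Rep (suc m) (λ u → guard (head u) (tail u))
rep-guard zero    = rep-ext rep-head λ { (y ∷ []) → refl }
rep-guard (suc m) = rep-ext (rep-ifz (rep-proj (suc zero)) (rep-const 0)
                                     (rep-comp (rep-guard m) (rep-head ∷ʳ reps-comp reps-tail reps-tail)))
                            λ { (y ∷ r ∷ rs) → refl }

reps-drop₃ : Reps (3 + n) n (tail ∘ tail ∘ tail)
reps-drop₃ = reps-comp reps-tail (reps-comp reps-tail reps-tail)

rep-run : (c : PR n) → Rep (suc n) (λ v → run c (head v) (tail v))
rep-runs : (gs : Vec (PR n) m) → Reps (suc n) m (λ v → runs gs (head v) (tail v))

rep-run Z           = rep-const 1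
rep-run S           = rep-ext (rep-suc (rep-suc (rep-proj (suc zero)))) λ { (s ∷ x ∷ []) → refl }
rep-run (proj i)    = rep-ext (rep-suc (rep-proj (suc i))) λ { (s ∷ xs) → refl }
rep-run (comp f gs) =
  rep-comp (rep-guard _) (rep-comp (rep-run f) (rep-head ∷ʳ reps-map (rep-pred rep-head) (rep-runs gs)) ∷ʳ rep-runs gs)
rep-run (prim f g)  =
  rep-ext (rep-comp (rep-primrec (rep-run f) step) (rep-proj (suc zero) ∷ʳ rep-head ∷ʳ reps-comp reps-tail reps-tail))
          λ { (s ∷ k ∷ xs) → refl }
  where
  step : Rep (3 + _) (λ w → ifz (lookup w (suc zero)) 0
                              (run g (lookup w (suc (suc zero))) (head w ∷ pred (lookup w (suc zero)) ∷ tail (tail (tail w)))))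
  step = rep-ifz (rep-proj (suc zero)) (rep-const 0)
           (rep-comp (rep-run g) (rep-proj (suc (suc zero)) ∷ʳ rep-head ∷ʳ rep-pred (rep-proj (suc zero)) ∷ʳ reps-drop₃))
rep-run (mu f)      = rep-pred (rep-comp (rep-primrec (rep-const 0) step) (rep-head ∷ʳ rep-head ∷ʳ reps-tail))
  where
  probe : Rep (3 + _) (λ w → run f (lookup w (suc (suc zero))) (head w ∷ tail (tail (tail w))))
  probe = rep-comp (rep-run f) (rep-proj (suc (suc zero)) ∷ʳ rep-head ∷ʳ reps-drop₃)
  step : Rep (3 + _) (λ w → ifz (lookup w (suc zero))
                              (searchStep (run f (lookup w (suc (suc zero))) (head w ∷ tail (tail (tail w)))) (head w))
                              (lookup w (suc zero)))
  step = rep-ifz (rep-proj (suc zero))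
           (rep-ifz probe (rep-const 1) (rep-ifz (rep-pred probe) (rep-suc (rep-suc rep-head)) (rep-const 0)))
           (rep-proj (suc zero))

rep-runs []       = []ʳ
rep-runs (g ∷ gs) = rep-run g ∷ʳ rep-runs gs

guard≡suc⇒ : ∀ y (rs : Vec ℕ m) {z} → guard y rs ≡ suc z → ∃ λ ys → rs ≡ map suc ys × y ≡ suc z
guard≡suc⇒ y []           y≡ = [] , refl , y≡
guard≡suc⇒ y (suc r ∷ rs) g≡ with guard≡suc⇒ y rs g≡
... | ys , rs≡ , y≡ = r ∷ ys , cong (suc r ∷_) rs≡ , y≡

guard-map-suc : ∀ y (ys : Vec ℕ m) → guard y (map suc ys) ≡ y
guard-map-suc y []       = refl
guard-map-suc y (_ ∷ ys) = guard-map-suc y ys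

map-pred-suc : (ys : Vec ℕ m) → map pred (map suc ys) ≡ ys
map-pred-suc ys = trans (sym (map-∘ pred suc ys)) (map-id ys)

PositiveBelow : (ℕ → ℕ) → ℕ → Set
PositiveBelow h i = ∀ j → j < i → ∃ λ m → h j ≡ 2 + m

PositiveBelow-suc : ∀ h i → PositiveBelow h (suc i) → PositiveBelow h i
PositiveBelow-suc h i pos j j<i = pos j (m≤n⇒m≤1+n j<i)

search≡0⇒ : ∀ h i → search h i ≡ 0 → PositiveBelow h i
search≡0⇒ h (suc i) e j j<1+i with search h i in e₀ | h i in eh
search≡0⇒ h (suc i) () j j<1+i | zero  | zero
search≡0⇒ h (suc i) () j j<1+i | zero  | suc zero
search≡0⇒ h (suc i) e  j j<1+i | zero  | suc (suc m) with m<1+n⇒m<n∨m≡n j<1+i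
... | inj₁ j<i  = search≡0⇒ h i e₀ j j<i
... | inj₂ refl = m , eh
search≡0⇒ h (suc i) () j j<1+i | suc _ | _

search≡2+⇒ : ∀ h i {k} → search h i ≡ 2 + k → h k ≡ 1 × PositiveBelow h k
search≡2+⇒ h (suc i) e with search h i in e₀ | h i in eh
search≡2+⇒ h (suc i) () | zero     | zero
search≡2+⇒ h (suc i) refl | zero   | suc zero = eh , search≡0⇒ h i e₀
search≡2+⇒ h (suc i) () | zero     | suc (suc _)
search≡2+⇒ h (suc i) refl | suc st | _ = search≡2+⇒ h i e₀

PositiveBelow⇒search≡0 : ∀ h i → PositiveBelow h i → search h i ≡ 0
PositiveBelow⇒search≡0 h zero    pos = refl
PositiveBelow⇒search≡0 h (suc i) pos
  rewrite PositiveBelow⇒search≡0 h i (PositiveBelow-suc h i pos) | proj₂ (pos i ≤-refl) = refl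

least⇒search≡2+ : ∀ h k → PositiveBelow h k → h k ≡ 1 → ∀ i → k < i → search h i ≡ 2 + k
least⇒search≡2+ h k pos hk≡1 (suc i) k<1+i with m<1+n⇒m<n∨m≡n k<1+i
... | inj₁ k<i  rewrite least⇒search≡2+ h k pos hk≡1 i k<i = refl
... | inj₂ refl rewrite PositiveBelow⇒search≡0 h k pos | hk≡1 = refl

pred≡suc⇒ : ∀ t {y} → pred t ≡ suc y → t ≡ 2 + y
pred≡suc⇒ (suc (suc t)) refl = refl

run-sound : (c : PR n) (s : ℕ) (xs : Vec ℕ n) {y : ℕ} → run c s xs ≡ suc y → c [ xs ]⇓ y
runs-sound : (gs : Vec (PR n) m) (s : ℕ) (xs : Vec ℕ n) (ys : Vec ℕ m) → runs gs s xs ≡ map suc ys → gs [ xs ]⇓* ys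
run-prim-sound : (f : PR n) (g : PR (2 + n)) (s : ℕ) (xs : Vec ℕ n) (k : ℕ) {y : ℕ} →
                 run (prim f g) s (k ∷ xs) ≡ suc y → prim f g [ k ∷ xs ]⇓ y

run-sound Z        s xs       refl = Z-ev
run-sound S        s (x ∷ []) refl = S-ev
run-sound (proj i) s xs       refl = proj-ev
run-sound (comp f gs) s xs e with guard≡suc⇒ _ (runs gs s xs) e
... | ys , rs≡ , f≡ =
  comp-ev (runs-sound gs s xs ys rs≡)
          (run-sound f s ys (trans (cong (run f s) (sym (trans (cong (map pred) rs≡) (map-pred-suc ys)))) f≡))
run-sound (prim f g) s (k ∷ xs) e = run-prim-sound f g s xs k e
run-sound (mu f) s xs e with search≡2+⇒ (λ j → run f s (j ∷ xs)) s (pred≡suc⇒ _ e)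
... | hit , pos = mu-ev (run-sound f s _ hit) λ j j<k → proj₁ (pos j j<k) , run-sound f s _ (proj₂ (pos j j<k))

runs-sound []       s xs []       refl = []-ev
runs-sound (g ∷ gs) s xs (y ∷ ys) e with ∷-injective e
... | g≡ , gs≡ = ∷-ev (run-sound g s xs g≡) (runs-sound gs s xs ys gs≡)

run-prim-sound f g s xs zero    e = prim-z (run-sound f s xs e)
run-prim-sound f g s xs (suc k) e with run (prim f g) s (k ∷ xs) in e₀
... | suc r = prim-s (run-prim-sound f g s xs k e₀) (run-sound g s _ e)

Eventually : (ℕ → Set) → Set
Eventually P = ∃ λ s₀ → ∀ s → s₀ ≤ s → P s

module _ {P Q : ℕ → Set} where

  eventually-map : (∀ {s} → P s → Q s) → Eventually P → Eventually Q
  eventually-map P⇒Q (s₀ , p) = s₀ , λ s s₀≤s → P⇒Q (p s s₀≤s)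

  eventually-× : Eventually P → Eventually Q → Eventually (λ s → P s × Q s)
  eventually-× (a , p) (b , q) = a ⊔ b , λ s a⊔b≤s → p s (m⊔n≤o⇒m≤o a b a⊔b≤s) , q s (m⊔n≤o⇒n≤o a b a⊔b≤s)

eventually-> : ∀ k → Eventually (k <_)
eventually-> k = suc k , λ _ k<s → k<s

eventually-∀< : {P : ℕ → ℕ → Set} (k : ℕ) → (∀ j → j < k → Eventually (P j)) →
                Eventually (λ s → ∀ j → j < k → P j s)
eventually-∀< zero    ev = 0 , λ _ _ j ()
eventually-∀< (suc k) ev =
  eventually-map (λ { (below , at) j j<1+k → [ below j , (λ { refl → at }) ]′ (m<1+n⇒m<n∨m≡n j<1+k) })
                 (eventually-× (eventually-∀< k λ j j<k → ev j (m≤n⇒m≤1+n j<k)) (ev k ≤-refl))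

run-complete : ∀ {c : PR n} {y} → c [ xs ]⇓ y → Eventually (λ s → run c s xs ≡ suc y)
runs-complete : ∀ {gs : Vec (PR n) m} {ys} → gs [ xs ]⇓* ys → Eventually (λ s → runs gs s xs ≡ map suc ys)
run-complete-positive : ∀ {c : PR n} → (∃ λ y → c [ xs ]⇓ suc y) → Eventually (λ s → ∃ λ y → run c s xs ≡ 2 + y)

run-complete Z-ev    = 0 , λ _ _ → refl
run-complete S-ev    = 0 , λ _ _ → refl
run-complete proj-ev = 0 , λ _ _ → refl
run-complete {xs = xs} (comp-ev {f = f} {gs} {ys = ys} ds d) =
  eventually-map (λ { {s} (rs≡ , f≡) →
    begin
      guard (run f s (map pred (runs gs s xs))) (runs gs s xs) ≡⟨ cong (λ rs → guard (run f s (map pred rs)) rs) rs≡ ⟩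
      guard (run f s (map pred (map suc ys))) (map suc ys)     ≡⟨ guard-map-suc _ ys ⟩
      run f s (map pred (map suc ys))                          ≡⟨ cong (run f s) (map-pred-suc ys) ⟩
      run f s ys                                               ≡⟨ f≡ ⟩
      _                                                        ∎ })
    (eventually-× (runs-complete ds) (run-complete d))
  where open ≡-Reasoning
run-complete (prim-z d) = run-complete d
run-complete {xs = _ ∷ xs} (prim-s {f = f} {g} {k = k} d e) =
  eventually-map (λ (r≡ , y≡) → trans (cong (λ t → ifz t 0 (run g _ (k ∷ pred t ∷ xs))) r≡) y≡)
                 (eventually-× (run-complete d) (run-complete e))
run-complete {xs = xs} (mu-ev {f = f} {k = k} d below) =
  eventually-map (λ { {s} ((hit , pos) , k<s) →
                   cong pred (least⇒search≡2+ (λ j → run f s (j ∷ xs)) k pos hit s k<s) })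
    (eventually-× (eventually-× (run-complete d) (eventually-∀< k λ j j<k → run-complete-positive (below j j<k)))
                  (eventually-> k))

runs-complete []-ev       = 0 , λ _ _ → refl
runs-complete (∷-ev d ds) = eventually-map (λ (y≡ , ys≡) → cong₂ _∷_ y≡ ys≡) (eventually-× (run-complete d) (runs-complete ds))

run-complete-positive (y , d) = eventually-map (λ y≡ → y , y≡) (run-complete d)

NonZeroBelow : (ℕ → ℕ) → ℕ → Set
NonZeroBelow g k = ∀ j → j < k → ∃ λ m → g j ≡ suc m

first-zero-or-NonZeroBelow : ∀ g n → (∃ λ k → g k ≡ 0 × NonZeroBelow g k) ⊎ NonZeroBelow g n
first-zero-or-NonZeroBelow g zero = inj₂ λ _ ()
first-zero-or-NonZeroBelow g (suc n) with first-zero-or-NonZeroBelow g n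
... | inj₁ first = inj₁ first
... | inj₂ below with g n in gn≡
...   | zero  = inj₁ (n , gn≡ , below)
...   | suc m = inj₂ λ j j<1+n → [ below j , (λ { refl → m , gn≡ }) ]′ (m<1+n⇒m<n∨m≡n j<1+n)

mu-halts : ∀ (c : PR (suc n)) (g : ℕ → ℕ) {k₀} → (∀ k → c [ k ∷ xs ]⇓ g k) → g k₀ ≡ 0 → ∃ λ k → mu c [ xs ]⇓ k
mu-halts c g {k₀} c⇓ gk₀≡0 with first-zero-or-NonZeroBelow g (suc k₀)
... | inj₁ (k , gk≡0 , below) =
  k , mu-ev (subst (c [ _ ]⇓_) gk≡0 (c⇓ k)) λ j j<k → proj₁ (below j j<k) , subst (c [ _ ]⇓_) (proj₂ (below j j<k)) (c⇓ j)
... | inj₂ below = ⊥-elim (0≢1+n (trans (sym gk₀≡0) (proj₂ (below k₀ ≤-refl))))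

anyZero : (ℕ → ℕ) → ℕ → ℕ
anyZero h = primrec 1 (λ i acc → ifz acc 0 (h i))

anyZero≡0⇒ : ∀ h n → anyZero h n ≡ 0 → ∃ λ i → i < n × h i ≡ 0
anyZero≡0⇒ h (suc n) e with anyZero h n in e₀
... | zero  = let i , i<n , hi≡0 = anyZero≡0⇒ h n e₀ in i , m≤n⇒m≤1+n i<n , hi≡0
... | suc _ = n , ≤-refl , e

anyZero≡0 : ∀ h {i n} → i < n → h i ≡ 0 → anyZero h n ≡ 0
anyZero≡0 h {n = suc n} i<1+n hi≡0 with m<1+n⇒m<n∨m≡n i<1+n
... | inj₁ i<n  rewrite anyZero≡0 h i<n hi≡0 = refl
... | inj₂ refl with anyZero h n
...   | zero  = refl
...   | suc _ = hi≡0

rep-anyZero : ∀ {t} → Rep (suc n) t → Rep (suc n) (λ v → anyZero (λ i → t (i ∷ tail v)) (head v))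
rep-anyZero rt = rep-primrec (rep-const 1) (rep-ifz (rep-proj (suc zero)) (rep-const 0)
                                                    (rep-comp rt (rep-head ∷ʳ reps-comp reps-tail reps-tail)))

distinct : ℕ → ℕ → ℕ
distinct a b = ifz (a ∸ b) (ifz (b ∸ a) 0 1) 1

distinct-refl : ∀ a → distinct a a ≡ 0
distinct-refl a rewrite n∸n≡0 a = refl

distinct≡0⇒ : ∀ a b → distinct a b ≡ 0 → a ≡ b
distinct≡0⇒ a b e with a ∸ b in a∸b | b ∸ a in b∸a
... | zero | zero = ≤-antisym (m∸n≡0⇒m≤n a∸b) (m∸n≡0⇒m≤n b∸a)

rep-distinct : ∀ {a b} → Rep n a → Rep n b → Rep n (λ xs → distinct (a xs) (b xs))
rep-distinct ra rb = rep-ifz (rep-∸ ra rb) (rep-ifz (rep-∸ rb ra) (rep-const 0) (rep-const 1)) (rep-const 1)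

module Image (cd cf : PR 1) where

  witnesses : ℕ → ℕ → ℕ → ℕ
  witnesses s v w = ifz (run cd s (w ∷ [])) 1 (distinct (run cf s (w ∷ [])) (suc v))

  witnesses≡0⇒ : ∀ s v w → witnesses s v w ≡ 0 → (∃ λ y → run cd s (w ∷ []) ≡ suc y) × run cf s (w ∷ []) ≡ suc v
  witnesses≡0⇒ s v w e with run cd s (w ∷ []) in d≡
  ... | suc y = (y , refl) , distinct≡0⇒ _ _ e

  witnesses≡0 : ∀ s v w {y} → run cd s (w ∷ []) ≡ suc y → run cf s (w ∷ []) ≡ suc v → witnesses s v w ≡ 0
  witnesses≡0 s v w d≡ f≡ rewrite d≡ | f≡ = distinct-refl (suc v)

  rep-witnessed : Rep 2 (λ u → anyZero (witnesses (head u) (lookup u (suc zero))) (head u))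
  rep-witnessed = rep-ext (rep-comp (rep-anyZero rep-witnesses) (rep-head ∷ʳ rep-head ∷ʳ reps-tail)) λ { (s ∷ v ∷ []) → refl }
    where
    at : (c : PR 1) → Rep 3 (λ u → run c (lookup u (suc zero)) (head u ∷ []))
    at c = rep-comp (rep-run c) (rep-proj (suc zero) ∷ʳ rep-head ∷ʳ []ʳ)
    rep-witnesses : Rep 3 (λ u → witnesses (lookup u (suc zero)) (lookup u (suc (suc zero))) (head u))
    rep-witnesses = rep-ifz (at cd) (rep-const 1) (rep-distinct (at cf) (rep-suc (rep-proj (suc (suc zero)))))

  image : PR 1
  image = mu (proj₁ rep-witnessed)

  image-halts : ∀ {w y v} → cd [ w ∷ [] ]⇓ y → cf [ w ∷ [] ]⇓ v → ∃ λ z → image [ v ∷ [] ]⇓ z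
  image-halts {w} {v = v} d e with eventually-× (eventually-× (run-complete d) (run-complete e)) (eventually-> w)
  ... | s , conv with conv s ≤-refl
  ...   | (d≡ , e≡) , w<s =
    mu-halts (proj₁ rep-witnessed) (λ s → anyZero (witnesses s v) s) {s} (λ s → proj₂ rep-witnessed (s ∷ v ∷ []))
             (anyZero≡0 (witnesses s v) w<s (witnesses≡0 s v w d≡ e≡))

  image-halts⁻¹ : ∀ {v z} → image [ v ∷ [] ]⇓ z → ∃ λ w → (∃ λ y → cd [ w ∷ [] ]⇓ y) × cf [ w ∷ [] ]⇓ v
  image-halts⁻¹ {v} {z} (mu-ev found _)
    with anyZero≡0⇒ (witnesses z v) z (⇓-functional (proj₂ rep-witnessed (z ∷ v ∷ [])) found)
  ... | w , _ , wit with witnesses≡0⇒ z v w wit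
  ...   | (y , d≡) , e≡ = w , (y , run-sound cd z _ d≡) , run-sound cf z _ e≡

enc-injective : ∀ u v → enc u ≡ enc v → u ≡ v
enc-injective []          []          _ = refl
enc-injective []          (false ∷ _) ()
enc-injective []          (true ∷ _)  ()
enc-injective (false ∷ _) []          ()
enc-injective (true ∷ _)  []          ()
enc-injective (false ∷ u) (false ∷ v) e = cong (false ∷_) (enc-injective u v (*-cancelˡ-≡ _ _ 2 (suc-injective e)))
enc-injective (true ∷ u)  (true ∷ v)  e = cong (true ∷_) (enc-injective u v (*-cancelˡ-≡ _ _ 2 (suc-injective (suc-injective e))))
enc-injective (false ∷ u) (true ∷ v)  e = ⊥-elim (even≢odd (enc u) (enc v) (suc-injective e))
enc-injective (true ∷ u)  (false ∷ v) e = ⊥-elim (even≢odd (enc v) (enc u) (sym (suc-injective e)))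

-- successor in bijective base 2, the numeration that enc reads
increment : Σ* → Σ*
increment []          = false ∷ []
increment (false ∷ u) = true ∷ u
increment (true ∷ u)  = false ∷ increment u

enc-increment : ∀ u → enc (increment u) ≡ suc (enc u)
enc-increment []          = refl
enc-increment (false ∷ u) = refl
enc-increment (true ∷ u)  = trans (cong (λ t → suc (2 * t)) (enc-increment u)) (cong suc (*-suc 2 (enc u)))

enc-surjective : ∀ n → ∃ λ u → enc u ≡ n
enc-surjective zero    = [] , refl
enc-surjective (suc n) = let u , u≡ = enc-surjective n in increment u , trans (enc-increment u) (cong suc u≡)

CE-image : ∀ {P : Σ* → Set} {f : Σ* → Σ*} → CE P → Computable f → CE (λ v → ∃ λ w → P w × f w ≡ v)
CE-image {P} {f} (cd , cd-spec) (cf , cf-spec) = image , λ v → halts v , halts⁻¹ v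
  where
  open Image cd cf
  halts : ∀ v → (∃ λ w → P w × f w ≡ v) → ∃ λ z → image [ enc v ∷ [] ]⇓ z
  halts v (w , Pw , refl) = image-halts (proj₂ (proj₁ (cd-spec w) Pw)) (cf-spec w)
  halts⁻¹ : ∀ v → (∃ λ z → image [ enc v ∷ [] ]⇓ z) → ∃ λ w → P w × f w ≡ v
  halts⁻¹ v (_ , d) with image-halts⁻¹ d
  ... | n , dom , e with enc-surjective n
  ...   | w , refl = w , proj₂ (cd-spec w) dom , enc-injective (f w) v (⇓-functional (cf-spec w) e)

Defined⇒just : {A : Set₁} (m : Maybe A) → Defined m → ∃ λ a → m ≡ just a
Defined⇒just (just a) _ = a , refl

just⇒Defined : {A : Set₁} {m : Maybe A} {a : A} → m ≡ just a → Defined m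
just⇒Defined refl = tt

-- Membership in a possibly undefined basic set; unlike quantifying over the basic set
-- itself, this stays in Set.
_∈ᴹ_ : {X : Set} → X → Maybe (Subset X) → Set
x ∈ᴹ just B  = B x
x ∈ᴹ nothing = ⊥

module _ {X : Set} {m : Maybe (Subset X)} {B : Subset X} {x : X} where

  ∈ᴹ⇒∈ : m ≡ just B → x ∈ᴹ m → B x
  ∈ᴹ⇒∈ refl Bx = Bx

  ∈⇒∈ᴹ : m ≡ just B → B x → x ∈ᴹ m
  ∈⇒∈ᴹ refl Bx = Bx

module NowhereDenseComplement {X : Set} (𝕏 : ComputableT0Space X) (A : Subset X) (nd : EffNowhereDense 𝕏 A) where
  open ComputableT0Space 𝕏

  private
    f = proj₁ nd
    shrink = proj₂ (proj₂ nd)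

  ShrunkIndex : Σ* → Set
  ShrunkIndex v = ∃ λ w → Defined (ν w) × f w ≡ v

  Shrunk : Subset X
  Shrunk x = Σ Σ* λ v → ShrunkIndex v × x ∈ᴹ ν v

  ShrunkIndex-ce : CE ShrunkIndex
  ShrunkIndex-ce = CE-image dom-ce (proj₁ (proj₂ nd))

  ShrunkIndex-basic : ∀ v → ShrunkIndex v → Σ (Subset X) λ B → ν v ≡ just B
  ShrunkIndex-basic _ (w , w-def , refl) =
    let Bw , ν≡ = Defined⇒just (ν w) w-def
        Bf , νf≡ , _ = shrink w Bw ν≡
    in Bf , νf≡

  Shrunk-dense : Dense 𝕏 Shrunk
  Shrunk-dense U U-open (x , Ux) =
    let w , Bw , ν≡ , _ , Bw⊆U = basis U U-open x Ux
        Bf , νf≡ , Bf⊆int = shrink w Bw ν≡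
        y , Bfy = basic-ne (f w) Bf νf≡
        _ , _ , Vy , V⊆ = Bf⊆int y Bfy
    in y , Bw⊆U y (proj₁ (V⊆ y Vy)) , f w , (w , just⇒Defined ν≡ , refl) , ∈⇒∈ᴹ νf≡ Bfy

  Shrunk-disjoint : ∀ x → Shrunk x → ¬ A x
  Shrunk-disjoint x (_ , (w , w-def , refl) , x∈) =
    let Bw , ν≡ = Defined⇒just (ν w) w-def
        Bf , νf≡ , Bf⊆int = shrink w Bw ν≡
        _ , _ , Vx , V⊆ = Bf⊆int x (∈ᴹ⇒∈ νf≡ x∈)
    in proj₂ (V⊆ x Vx)

  Shrunk-union : ∀ x → (Shrunk x → Σ Σ* λ v → Σ (Subset X) λ B → ShrunkIndex v × ν v ≡ just B × B x)
                     × ((Σ Σ* λ v → Σ (Subset X) λ B → ShrunkIndex v × ν v ≡ just B × B x) → Shrunk x)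
  Shrunk-union x = (λ (v , v∈ , x∈) → let B , ν≡ = ShrunkIndex-basic v v∈ in v , B , v∈ , ν≡ , ∈ᴹ⇒∈ ν≡ x∈)
                 , (λ (v , _ , v∈ , ν≡ , Bx) → v , v∈ , ∈⇒∈ᴹ ν≡ Bx)

mainTheorem7 : {X : Set} (𝕏 : ComputableT0Space X) (A : Subset X) →
    EffNowhereDense 𝕏 A →
    Σ (Subset X) λ D → CEOpen 𝕏 D × Dense 𝕏 D × (∀ x → D x → ¬ A x)
mainTheorem7 𝕏 A nd =
  Shrunk , (ShrunkIndex , ShrunkIndex-ce , ShrunkIndex-basic , Shrunk-union) , Shrunk-dense , Shrunk-disjoint
  where open NowhereDenseComplement 𝕏 A nd
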